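{- For $\mathbf N=(1,1,\dots,1,-n)\in\mathbb Z^{n+1}$, \[ \log K_n(\mathbf N)\ge\frac n4\log^2 n-O(n\log n) \] as $n\to\infty$. Further, $\log K_n(\mathbf N)\ge(n-1)\log(n+1)$ for all $n\ge3000$.
   Context: $K_n(\mathbf N)$ denotes the number of integer vectors $(f_{ij})_{0\le i<j\le n}$ with $f_{ij}\ge0$ and $\sum_{j>i}f_{ij}-\sum_{k<i}f_{ki}=N_i$ for all $i\in\{0,\dots,n\}$ (integer flows on the complete directed graph on $\{0,\dots,n\}$ with netflow $\mathbf N$). Logarithms are natural. -}

module Defs where

open import Data.Nat using (ℕ; zero; suc; _+_; _*_; _≤_; _^_; _≡ᵇ_; _<ᵇ_; _!)

open import Data.Fin using (Fin; toℕ)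
open import Data.Integer using (ℤ; +_; -_; _-_)
open import Data.Bool using (if_then_else_; false)
open import Data.Product using (Σ; ∃; _×_)
open import Relation.Binary.PropositionalEquality using (_≡_; _≢_)

sumFin : {n : ℕ} → (Fin n → ℕ) → ℕ
sumFin {zero}  f = 0
sumFin {suc n} f = f Fin.zero + sumFin (λ i → f (Fin.suc i))

Weights : ℕ → Set
Weights n = Fin (suc n) → Fin (suc n) → ℕ

outflow : {n : ℕ} → Weights n → Fin (suc n) → ℕ
outflow f i = sumFin (λ j → if toℕ i <ᵇ toℕ j then f i j else 0)

inflow : {n : ℕ} → Weights n → Fin (suc n) → ℕ
inflow f i = sumFin (λ k → if toℕ k <ᵇ toℕ i then f k i else 0)

-- Entries f i j with i ≥ j are
-- not edges and are required to be 0 (so flows ↔ vectors (f_ij)_{i<j}).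
IsFlow : (n : ℕ) → (Fin (suc n) → ℤ) → Weights n → Set
IsFlow n N f =
  (∀ i j → (toℕ i <ᵇ toℕ j) ≡ false → f i j ≡ 0) ×
  (∀ i → (+ outflow f i) - (+ inflow f i) ≡ N i)

-- "K_n(N) ≥ M": there are M pairwise distinct flows with netflow N.
KAtLeast : (n : ℕ) → (Fin (suc n) → ℤ) → ℕ → Set
KAtLeast n N M =
  Σ (Fin M → Weights n) λ g →
    (∀ m → IsFlow n N (g m)) ×
    (∀ a b → a ≢ b → ∃ λ i → ∃ λ j → g a i j ≢ g b i j)

Nvec : (n : ℕ) → Fin (suc n) → ℤ
Nvec n i = if toℕ i ≡ᵇ n then - (+ n) else + 1

-- expPartial m k = k! · Σ_{j=0}^{k} m^j / j!   (a natural number)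
expPartial : ℕ → ℕ → ℕ
expPartial m zero    = 1
expPartial m (suc k) = suc k * expPartial m k + m ^ suc k

-- ExpLe m x  ⇔  e^m ≤ x   (e^m is the supremum of its partial sums)
ExpLe : ℕ → ℕ → Set
ExpLe m x = ∀ k → expPartial m k ≤ x * (k !)

-- Flows with netflow (1, …, 1, −n) are built greedily.  The vertices 0, …, n − 1 are processed
-- in order, each holding a stock of units (its own unit plus those received); from vertex a on,
-- every vertex receives one unit from each of t earlier vertices of positive stock, and the final
-- stocks go to the sink n.  Every stock is at most t + 1 while the total stock before v is v, so
-- once a ≥ (t + 1) t L there are at least t L stocked vertices, and the t senders can be chosen
-- independently, one from each of t blocks of L consecutively ranked stocked vertices.  This gives
-- L ^ ((n − a) t) flows; they are pairwise distinct since at the first vertex where two choice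
-- sequences differ the stocks still agree, so a unit arrives there along different edges.
-- With t = L = 2^j and a = 2^(3j+1) for 16^j ≤ n < 16^(j+1) this is at least n^((j+1) n)
-- ≥ exp((n/4) log² n); with t = 4, L = ⌊n/40⌋ and a = 20 L it is at least (n+1)^(n−1).

module Submission where

open import Defs
open import Data.Nat
open import Data.Nat.Properties
open import Data.Nat.DivMod
open import Data.Nat.Induction using (<-rec)
open import Data.Nat.Tactic.RingSolver using (solve-∀)
open import Data.Bool using (Bool; true; false; _∧_; if_then_else_)
open import Data.Bool.Properties using (∧-zeroʳ)
open import Data.Product using (Σ; _×_; _,_; ∃)
open import Data.Sum using (inj₁; inj₂)
open import Data.Empty using (⊥-elim)
open import Data.Fin using (Fin; toℕ; fromℕ<; inject≤)
open import Data.Fin.Properties using (toℕ<n; toℕ-fromℕ<; toℕ-injective; inject≤-injective)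
import Data.Integer as ℤ
import Data.Integer.Properties as ℤᵖ
open import Function using (_∘_)
open import Relation.Nullary using (¬_; yes; no)
open import Relation.Nullary.Decidable using (dec-true; dec-false)
open import Relation.Binary.PropositionalEquality

[m*n+o]%n≡o : ∀ m n o .{{_ : NonZero n}} → o < n → (m * n + o) % n ≡ o
[m*n+o]%n≡o m n o o<n = begin
  (m * n + o) % n ≡⟨ cong (_% n) (+-comm (m * n) o) ⟩
  (o + m * n) % n ≡⟨ [m+kn]%n≡m%n o m n ⟩
  o % n           ≡⟨ m<n⇒m%n≡m o<n ⟩
  o               ∎
  where open ≡-Reasoning

[m*n+o]/n≡m : ∀ m n o .{{_ : NonZero n}} → o < n → (m * n + o) / n ≡ m
[m*n+o]/n≡m m n o o<n = begin
  (m * n + o) / n         ≡⟨ cong (_/ n) (+-comm (m * n) o) ⟩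
  (o + m * n) / n         ≡⟨ +-distrib-/ o (m * n) remainders<n ⟩
  o / n + m * n / n       ≡⟨ cong₂ _+_ (m<n⇒m/n≡0 o<n) (m*n/n≡m m n) ⟩
  m                       ∎
  where
  open ≡-Reasoning
  remainders<n : o % n + m * n % n < n
  remainders<n = subst (_< n) (sym (begin
    o % n + m * n % n ≡⟨ cong (o % n +_) (m*n%n≡0 m n) ⟩
    o % n + 0         ≡⟨ +-identityʳ _ ⟩
    o % n             ≡⟨ m<n⇒m%n≡m o<n ⟩
    o                 ∎)) o<n

m*n+o<k*n : ∀ {m n o k} → m < k → o < n → m * n + o < k * n
m*n+o<k*n {m} {n} {o} {k} m<k o<n = begin-strict
  m * n + o <⟨ +-monoʳ-< (m * n) o<n ⟩
  m * n + n ≡⟨ +-comm (m * n) n ⟩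
  suc m * n ≤⟨ *-monoˡ-≤ n m<k ⟩
  k * n     ∎
  where open ≤-Reasoning

+[1+m]-+m≡1 : ∀ m → ℤ.+ suc m ℤ.- ℤ.+ m ≡ ℤ.+ 1
+[1+m]-+m≡1 m = begin
  ℤ.+ suc m ℤ.- ℤ.+ m ≡⟨ ℤᵖ.m-n≡m⊖n (suc m) m ⟩
  suc m ℤ.⊖ m         ≡⟨ ℤᵖ.⊖-≥ (n≤1+n m) ⟩
  ℤ.+ (suc m ∸ m)     ≡⟨ cong ℤ.+_ (m+n∸n≡m 1 m) ⟩
  ℤ.+ 1               ∎
  where open ≡-Reasoning

^-cancelˡ-< : ∀ b .{{_ : NonZero b}} {m n} → b ^ m < b ^ n → m < n
^-cancelˡ-< b {m} {n} bᵐ<bⁿ with m <? n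
... | yes m<n = m<n
... | no  m≮n = ⊥-elim (<⇒≱ bᵐ<bⁿ (^-monoʳ-≤ b (≮⇒≥ m≮n)))

^-cancelˡ-≤ : ∀ b → 1 < b → ∀ {m n} → b ^ m ≤ b ^ n → m ≤ n
^-cancelˡ-≤ b 1<b {m} {n} bᵐ≤bⁿ with m ≤? n
... | yes m≤n = m≤n
... | no  m≰n = ⊥-elim (<⇒≱ (^-monoʳ-< b 1<b (≰⇒> m≰n)) bᵐ≤bⁿ)

m+m≤n⇒n≤[n∸m]*2 : ∀ {m n} → m + m ≤ n → n ≤ (n ∸ m) * 2
m+m≤n⇒n≤[n∸m]*2 {m} {n} 2m≤n = begin
  n                 ≡⟨ m∸n+n≡m (m+n≤o⇒n≤o m 2m≤n) ⟨
  (n ∸ m) + m       ≤⟨ +-monoʳ-≤ (n ∸ m) (m+n≤o⇒m≤o∸n m 2m≤n) ⟩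
  (n ∸ m) + (n ∸ m) ≡⟨ double (n ∸ m) ⟩
  (n ∸ m) * 2       ∎
  where
  open ≤-Reasoning
  double : ∀ x → x + x ≡ x * 2
  double = solve-∀

[m∸1]^q<n^q⇒m≤n : ∀ m n q → (m ∸ 1) ^ q < n ^ q → m ≤ n
[m∸1]^q<n^q⇒m≤n zero    n q _ = z≤n
[m∸1]^q<n^q⇒m≤n (suc m) n q m^q<n^q with n ≤? m
... | yes n≤m = ⊥-elim (<⇒≱ m^q<n^q (^-monoˡ-≤ q n≤m))
... | no  n≰m = ≰⇒> n≰m

∑< : ℕ → (ℕ → ℕ) → ℕ
∑< zero    g = 0
∑< (suc m) g = ∑< m g + g m

syntax ∑< m (λ u → e) = ∑[ u < m ] e

∑<-cong : ∀ m {g h : ℕ → ℕ} → (∀ u → u < m → g u ≡ h u) → ∑< m g ≡ ∑< m h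
∑<-cong zero    eq = refl
∑<-cong (suc m) eq = cong₂ _+_ (∑<-cong m (λ u u<m → eq u (m<n⇒m<1+n u<m))) (eq m ≤-refl)

∑<-zero : ∀ m {g : ℕ → ℕ} → (∀ u → u < m → g u ≡ 0) → ∑< m g ≡ 0
∑<-zero zero    eq = refl
∑<-zero (suc m) eq = cong₂ _+_ (∑<-zero m (λ u u<m → eq u (m<n⇒m<1+n u<m))) (eq m ≤-refl)

∑<-unfoldˡ : ∀ m (g : ℕ → ℕ) → ∑< (suc m) g ≡ g 0 + ∑< m (g ∘ suc)
∑<-unfoldˡ zero    g = +-comm 0 (g 0)
∑<-unfoldˡ (suc m) g rewrite ∑<-unfoldˡ m g = +-assoc (g 0) _ _

∑<-distrib-+ : ∀ m (g h : ℕ → ℕ) → ∑[ u < m ] (g u + h u) ≡ ∑< m g + ∑< m h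
∑<-distrib-+ zero    g h = refl
∑<-distrib-+ (suc m) g h rewrite ∑<-distrib-+ m g h = interchange (∑< m g) (∑< m h) (g m) (h m)
  where
  interchange : ∀ w x y z → w + x + (y + z) ≡ w + y + (x + z)
  interchange = solve-∀

∑<-split : ∀ m k (g : ℕ → ℕ) → ∑< (m + k) g ≡ ∑< m g + ∑[ i < k ] g (m + i)
∑<-split m zero    g rewrite +-identityʳ m = sym (+-identityʳ (∑< m g))
∑<-split m (suc k) g rewrite +-suc m k | ∑<-split m k g = +-assoc (∑< m g) _ _

∑<-extend : ∀ {m m'} (g : ℕ → ℕ) → m ≤ m' → (∀ u → m ≤ u → g u ≡ 0) → ∑< m' g ≡ ∑< m g
∑<-extend {m} {m'} g m≤m' vanish = begin
  ∑< m' g                            ≡⟨ cong (λ k → ∑< k g) (sym (m+[n∸m]≡n m≤m')) ⟩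
  ∑< (m + (m' ∸ m)) g                ≡⟨ ∑<-split m (m' ∸ m) g ⟩
  ∑< m g + ∑[ i < m' ∸ m ] g (m + i) ≡⟨ cong (∑< m g +_) (∑<-zero (m' ∸ m) (λ i _ → vanish (m + i) (m≤m+n m i))) ⟩
  ∑< m g + 0                         ≡⟨ +-identityʳ _ ⟩
  ∑< m g                             ∎
  where open ≡-Reasoning

sumFin≡∑< : ∀ m (h : ℕ → ℕ) → sumFin {m} (h ∘ toℕ) ≡ ∑< m h
sumFin≡∑< zero    h = refl
sumFin≡∑< (suc m) h = trans (cong (h 0 +_) (sumFin≡∑< m (h ∘ suc))) (sym (∑<-unfoldˡ m h))

≡ᵇ-refl : ∀ m → (m ≡ᵇ m) ≡ true
≡ᵇ-refl m = dec-true (m ≟ m) refl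

≡ᵇ-false : ∀ {m n} → m ≢ n → (m ≡ᵇ n) ≡ false
≡ᵇ-false {m} {n} = dec-false (m ≟ n)

<ᵇ-true : ∀ {m n} → m < n → (m <ᵇ n) ≡ true
<ᵇ-true {m} {n} = dec-true (m <? n)

<ᵇ-false : ∀ {m n} → ¬ m < n → (m <ᵇ n) ≡ false
<ᵇ-false {m} {n} = dec-false (m <? n)

≤ᵇ-true : ∀ {m n} → m ≤ n → (m ≤ᵇ n) ≡ true
≤ᵇ-true {m} {n} = dec-true (m ≤? n)

≤ᵇ-false : ∀ {m n} → ¬ m ≤ n → (m ≤ᵇ n) ≡ false
≤ᵇ-false {m} {n} = dec-false (m ≤? n)

𝟙 : Bool → ℕ
𝟙 true  = 1
𝟙 false = 0

𝟙≤1 : ∀ b → 𝟙 b ≤ 1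
𝟙≤1 true  = ≤-refl
𝟙≤1 false = z≤n

∑<-𝟙-≡ᵇ-beyond : ∀ m y → m ≤ y → ∑[ i < m ] 𝟙 (i ≡ᵇ y) ≡ 0
∑<-𝟙-≡ᵇ-beyond m y m≤y = ∑<-zero m (λ i i<m → cong 𝟙 (≡ᵇ-false (λ i≡y → <-irrefl i≡y (<-≤-trans i<m m≤y))))

∑<-𝟙-≡ᵇ : ∀ m y → y < m → ∑[ i < m ] 𝟙 (i ≡ᵇ y) ≡ 1
∑<-𝟙-≡ᵇ (suc m) y y<1+m with m ≟ y
... | yes refl rewrite ∑<-𝟙-≡ᵇ-beyond m m ≤-refl | ≡ᵇ-refl m = refl
... | no m≢y with m<1+n⇒m<n∨m≡n y<1+m
...   | inj₁ y<m rewrite ∑<-𝟙-≡ᵇ m y y<m | ≡ᵇ-false m≢y = refl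
...   | inj₂ y≡m = ⊥-elim (m≢y (sym y≡m))

positive : ℕ → Bool
positive zero    = false
positive (suc _) = true

rank : (ℕ → ℕ) → ℕ → ℕ
rank s u = ∑[ w < u ] 𝟙 (positive (s w))

∑<-positive∧rank : ∀ (s : ℕ → ℕ) (Q : ℕ → Bool) m →
  ∑[ u < m ] 𝟙 (positive (s u) ∧ Q (rank s u)) ≡ ∑[ r < rank s m ] 𝟙 (Q r)
∑<-positive∧rank s Q zero = refl
∑<-positive∧rank s Q (suc m) with s m
... | zero  rewrite ∑<-positive∧rank s Q m | +-identityʳ (rank s m) = +-identityʳ _
... | suc _ rewrite ∑<-positive∧rank s Q m | +-comm (rank s m) 1 = refl

∑<≤bound*rank : ∀ (s : ℕ → ℕ) c → (∀ u → s u ≤ c) → ∀ m → ∑< m s ≤ c * rank s m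
∑<≤bound*rank s c s≤c zero = z≤n
∑<≤bound*rank s c s≤c (suc m) with s m in eq
... | zero  rewrite +-identityʳ (∑< m s) | +-identityʳ (rank s m) = ∑<≤bound*rank s c s≤c m
... | suc _ rewrite *-distribˡ-+ c (rank s m) 1 | *-identityʳ c =
      +-mono-≤ (∑<≤bound*rank s c s≤c m) (subst (_≤ c) eq (s≤c m))

rank-cong : ∀ {s₁ s₂ : ℕ → ℕ} → (∀ u → s₁ u ≡ s₂ u) → ∀ m → rank s₁ m ≡ rank s₂ m
rank-cong eq m = ∑<-cong m (λ u _ → cong (𝟙 ∘ positive) (eq u))

vertex-of-rank : ∀ (s : ℕ → ℕ) m r → r < rank s m →
  Σ ℕ λ u → u < m × positive (s u) ≡ true × rank s u ≡ r
vertex-of-rank s (suc m) r r<rank with r <? rank s m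
... | yes r<rank' with vertex-of-rank s m r r<rank'
...   | u , u<m , pos , rk = u , m<n⇒m<1+n u<m , pos , rk
vertex-of-rank s (suc m) r r<rank | no r≮rank with s m in eq
...   | zero  rewrite +-identityʳ (rank s m) = ⊥-elim (r≮rank r<rank)
...   | suc _ = m , ≤-refl , cong positive eq ,
                ≤-antisym (≮⇒≥ r≮rank) (m<1+n⇒m≤n (subst (r <_) (+-comm (rank s m) 1) r<rank))

-- stock ch v u is what vertex u holds before vertex v is processed; vertex v ≥ a takes one unit
-- from each stocked vertex of rank k * L + ch v k, k < t.
module Greedy (a t L : ℕ) .{{_ : NonZero L}} where

  deg : ℕ → ℕ
  deg v = if a ≤ᵇ v then t else 0

  selects : (ℕ → ℕ) → ℕ → Bool
  selects c r = (r <ᵇ t * L) ∧ (r % L ≡ᵇ c (r / L))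

  picks : (ℕ → ℕ → ℕ) → (ℕ → ℕ) → ℕ → ℕ → Bool
  picks ch s v u = (a ≤ᵇ v) ∧ (positive (s u) ∧ selects (ch v) (rank s u))

  stock : (ℕ → ℕ → ℕ) → ℕ → ℕ → ℕ
  stock ch zero    u = 0
  stock ch (suc v) u =
    if u ≡ᵇ v then suc (deg v) else stock ch v u ∸ 𝟙 (picks ch (stock ch v) v u)

  sends : (ℕ → ℕ → ℕ) → ℕ → ℕ → Bool
  sends ch v u = picks ch (stock ch v) v u

  deg≤t : ∀ v → deg v ≤ t
  deg≤t v with a ≤ᵇ v
  ... | true  = ≤-refl
  ... | false = z≤n

  𝟙-picks≤ : ∀ ch s v u → 𝟙 (picks ch s v u) ≤ s u
  𝟙-picks≤ ch s v u with a ≤ᵇ v | s u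
  ... | false | _     = z≤n
  ... | true  | zero  = z≤n
  ... | true  | suc _ = ≤-trans (𝟙≤1 _) (s≤s z≤n)

  selects-≥ : ∀ (c : ℕ → ℕ) {r} → t * L ≤ r → selects c r ≡ false
  selects-≥ c tL≤r rewrite <ᵇ-false (≤⇒≯ tL≤r) = refl

  selects-< : ∀ (c : ℕ → ℕ) {r} → r < t * L → selects c r ≡ (r % L ≡ᵇ c (r / L))
  selects-< c r<tL rewrite <ᵇ-true r<tL = refl

  selects-cong : ∀ {c₁ c₂} r → (∀ k → k < t → c₁ k ≡ c₂ k) → selects c₁ r ≡ selects c₂ r
  selects-cong {c₁} {c₂} r agree with r <? t * L
  ... | yes r<tL rewrite selects-< c₁ r<tL | selects-< c₂ r<tL | agree (r / L) (m<n*o⇒m/o<n r<tL) = refl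
  ... | no  r≮tL rewrite selects-≥ c₁ (≮⇒≥ r≮tL) | selects-≥ c₂ (≮⇒≥ r≮tL) = refl

  ∑<-block-choices : ∀ (c : ℕ → ℕ) → (∀ k → c k < L) → ∀ k → ∑[ r < k * L ] 𝟙 (r % L ≡ᵇ c (r / L)) ≡ k
  ∑<-block-choices c c<L zero    = refl
  ∑<-block-choices c c<L (suc k) = begin
    ∑< (L + k * L) g                ≡⟨ cong (λ m → ∑< m g) (+-comm L (k * L)) ⟩
    ∑< (k * L + L) g                ≡⟨ ∑<-split (k * L) L g ⟩
    ∑< (k * L) g + ∑[ i < L ] g (k * L + i)
      ≡⟨ cong₂ _+_ (∑<-block-choices c c<L k) (∑<-cong L in-block-k) ⟩
    k + ∑[ i < L ] 𝟙 (i ≡ᵇ c k)    ≡⟨ cong (k +_) (∑<-𝟙-≡ᵇ L (c k) (c<L k)) ⟩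
    k + 1                           ≡⟨ +-comm k 1 ⟩
    suc k                           ∎
    where
    open ≡-Reasoning
    g : ℕ → ℕ
    g r = 𝟙 (r % L ≡ᵇ c (r / L))
    in-block-k : ∀ i → i < L → g (k * L + i) ≡ 𝟙 (i ≡ᵇ c k)
    in-block-k i i<L rewrite [m*n+o]%n≡o k L i i<L | [m*n+o]/n≡m k L i i<L = refl

  ∑<-picked : ∀ (s c : ℕ → ℕ) → (∀ k → c k < L) → ∀ v → t * L ≤ rank s v →
    ∑[ u < v ] 𝟙 (positive (s u) ∧ selects c (rank s u)) ≡ t
  ∑<-picked s c c<L v tL≤rank = begin
    ∑[ u < v ] 𝟙 (positive (s u) ∧ selects c (rank s u)) ≡⟨ ∑<-positive∧rank s (selects c) v ⟩
    ∑[ r < rank s v ] 𝟙 (selects c r)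
      ≡⟨ ∑<-extend (𝟙 ∘ selects c) tL≤rank (λ r tL≤r → cong 𝟙 (selects-≥ c tL≤r)) ⟩
    ∑[ r < t * L ] 𝟙 (selects c r)      ≡⟨ ∑<-cong (t * L) (λ r r<tL → cong 𝟙 (selects-< c r<tL)) ⟩
    ∑[ r < t * L ] 𝟙 (r % L ≡ᵇ c (r / L)) ≡⟨ ∑<-block-choices c c<L t ⟩
    t                                     ∎
    where open ≡-Reasoning

  module Run (ch : ℕ → ℕ → ℕ) (ch<L : ∀ v k → ch v k < L) (tL≤a : suc t * (t * L) ≤ a) where

    stock-unborn : ∀ v u → v ≤ u → stock ch v u ≡ 0
    stock-unborn zero    u _   = refl
    stock-unborn (suc v) u v<u
      rewrite ≡ᵇ-false {u} {v} (λ u≡v → <-irrefl (sym u≡v) v<u)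
            | stock-unborn v u (≤-trans (n≤1+n v) v<u) = 0∸n≡0 (𝟙 ((a ≤ᵇ v) ∧ false))

    stock≤1+t : ∀ v u → stock ch v u ≤ suc t
    stock≤1+t zero    u = z≤n
    stock≤1+t (suc v) u with u ≡ᵇ v
    ... | true  = s≤s (deg≤t v)
    ... | false = ≤-trans (m∸n≤m (stock ch v u) (𝟙 (sends ch v u))) (stock≤1+t v u)

    stock-new : ∀ v → stock ch (suc v) v ≡ suc (deg v)
    stock-new v rewrite ≡ᵇ-refl v = refl

    stock-old : ∀ v u → u ≢ v → stock ch (suc v) u ≡ stock ch v u ∸ 𝟙 (sends ch v u)
    stock-old v u u≢v rewrite ≡ᵇ-false u≢v = refl

    sends-unborn : ∀ w u → w ≤ u → sends ch w u ≡ false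
    sends-unborn w u w≤u rewrite stock-unborn w u w≤u = ∧-zeroʳ (a ≤ᵇ w)

    rank-large : ∀ v → a ≤ v → ∑< v (stock ch v) ≡ v → t * L ≤ rank (stock ch v) v
    rank-large v a≤v total = *-cancelˡ-≤ (suc t) (begin
      suc t * (t * L)              ≤⟨ tL≤a ⟩
      a                            ≤⟨ a≤v ⟩
      v                            ≡⟨ total ⟨
      ∑< v (stock ch v)            ≤⟨ ∑<≤bound*rank (stock ch v) (suc t) (stock≤1+t v) v ⟩
      suc t * rank (stock ch v) v  ∎)
      where open ≤-Reasoning

    ∑<-sends≡deg′ : ∀ v → ∑< v (stock ch v) ≡ v → ∑[ u < v ] 𝟙 (sends ch v u) ≡ deg v
    ∑<-sends≡deg′ v total with a ≤? v
    ... | yes a≤v rewrite ≤ᵇ-true a≤v =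
          ∑<-picked (stock ch v) (ch v) (ch<L v) v (rank-large v a≤v total)
    ... | no  a≰v rewrite ≤ᵇ-false a≰v = ∑<-zero v (λ _ _ → refl)

    stock-total : ∀ v → ∑< v (stock ch v) ≡ v
    stock-total zero    = refl
    stock-total (suc v) = begin
      ∑< v (stock ch (suc v)) + stock ch (suc v) v
        ≡⟨ cong₂ _+_ (∑<-cong v (λ u u<v → stock-old v u (<⇒≢ u<v))) (stock-new v) ⟩
      ∑[ u < v ] (s u ∸ b u) + suc (deg v)       ≡⟨ +-suc _ (deg v) ⟩
      suc (∑[ u < v ] (s u ∸ b u) + deg v)       ≡⟨ cong (λ d → suc (∑[ u < v ] (s u ∸ b u) + d)) (∑<-sends≡deg′ v (stock-total v)) ⟨
      suc (∑[ u < v ] (s u ∸ b u) + ∑< v b)      ≡⟨ cong suc (∑<-distrib-+ v (λ u → s u ∸ b u) b) ⟨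
      suc (∑[ u < v ] (s u ∸ b u + b u))         ≡⟨ cong suc (∑<-cong v (λ u _ → m∸n+n≡m (𝟙-picks≤ ch s v u))) ⟩
      suc (∑< v s)                               ≡⟨ cong suc (stock-total v) ⟩
      suc v                                      ∎
      where
      open ≡-Reasoning
      s b : ℕ → ℕ
      s = stock ch v
      b = 𝟙 ∘ sends ch v

    ∑<-sends≡deg : ∀ v → ∑[ u < v ] 𝟙 (sends ch v u) ≡ deg v
    ∑<-sends≡deg v = ∑<-sends≡deg′ v (stock-total v)

    stocked≥t*L : ∀ v → a ≤ v → t * L ≤ rank (stock ch v) v
    stocked≥t*L v a≤v = rank-large v a≤v (stock-total v)

    stock+sent : ∀ v u → u < v → stock ch v u + ∑[ w < v ] 𝟙 (sends ch w u) ≡ suc (deg u)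
    stock+sent (suc v) u u<1+v with m<1+n⇒m<n∨m≡n u<1+v
    ... | inj₂ refl
      rewrite stock-new u
            | ∑<-zero u (λ w w<u → cong 𝟙 (sends-unborn w u (<⇒≤ w<u)))
            | sends-unborn u u ≤-refl = cong suc (+-identityʳ (deg u))
    ... | inj₁ u<v rewrite stock-old v u (<⇒≢ u<v) = begin
      s u ∸ b + (sent + b)  ≡⟨ rearrange (s u ∸ b) sent b ⟩
      (s u ∸ b + b) + sent  ≡⟨ cong (_+ sent) (m∸n+n≡m (𝟙-picks≤ ch s v u)) ⟩
      s u + sent            ≡⟨ stock+sent v u u<v ⟩
      suc (deg u)           ∎
      where
      open ≡-Reasoning
      s : ℕ → ℕ
      s = stock ch v
      b sent : ℕ
      b = 𝟙 (sends ch v u)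
      sent = ∑[ w < v ] 𝟙 (sends ch w u)
      rearrange : ∀ x y z → x + (y + z) ≡ x + z + y
      rearrange x y z rewrite +-comm y z = sym (+-assoc x z y)

    flow : ℕ → ℕ → ℕ → ℕ
    flow n u w = if u <ᵇ w then (if w ≡ᵇ n then stock ch n u else 𝟙 (sends ch w u)) else 0

    module _ (n : ℕ) where

      outgoing incoming : ℕ → ℕ
      outgoing u = ∑[ w < suc n ] (if u <ᵇ w then flow n u w else 0)
      incoming u = ∑[ k < suc n ] (if k <ᵇ u then flow n k u else 0)

      outgoing-term : ∀ u w → w < n → (if u <ᵇ w then flow n u w else 0) ≡ 𝟙 (sends ch w u)
      outgoing-term u w w<n with u <? w
      ... | yes u<w rewrite <ᵇ-true u<w | ≡ᵇ-false (<⇒≢ w<n) = refl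
      ... | no  u≮w rewrite <ᵇ-false u≮w | sends-unborn w u (≮⇒≥ u≮w) = refl

      incoming-term : ∀ u k → u < n → (if k <ᵇ u then flow n k u else 0) ≡ 𝟙 (sends ch u k)
      incoming-term u k u<n with k <? u
      ... | yes k<u rewrite <ᵇ-true k<u | ≡ᵇ-false (<⇒≢ u<n) = refl
      ... | no  k≮u rewrite <ᵇ-false k≮u | sends-unborn u k (≮⇒≥ k≮u) = refl

      outgoing-inner : ∀ u → u < n → outgoing u ≡ suc (deg u)
      outgoing-inner u u<n rewrite ∑<-cong n (outgoing-term u) | <ᵇ-true u<n | ≡ᵇ-refl n =
        trans (+-comm _ (stock ch n u)) (stock+sent n u u<n)

      outgoing-sink : outgoing n ≡ 0
      outgoing-sink = ∑<-zero (suc n) (λ w w<1+n →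
        cong (λ b → if b then flow n n w else 0) (<ᵇ-false (≤⇒≯ (m<1+n⇒m≤n w<1+n))))

      incoming-inner : ∀ u → u < n → incoming u ≡ deg u
      incoming-inner u u<n = begin
        incoming u                           ≡⟨ ∑<-cong (suc n) (λ k _ → incoming-term u k u<n) ⟩
        ∑[ k < suc n ] 𝟙 (sends ch u k)
          ≡⟨ ∑<-extend (𝟙 ∘ sends ch u) (≤-trans (<⇒≤ u<n) (n≤1+n n)) (λ k u≤k → cong 𝟙 (sends-unborn u k u≤k)) ⟩
        ∑[ k < u ] 𝟙 (sends ch u k)    ≡⟨ ∑<-sends≡deg u ⟩
        deg u                          ∎
        where open ≡-Reasoning

      incoming-sink : incoming n ≡ n
      incoming-sink
        rewrite <ᵇ-false (<-irrefl {n} refl) | +-identityʳ (∑[ k < n ] (if k <ᵇ n then flow n k n else 0)) =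
        trans (∑<-cong n final-stock) (stock-total n)
        where
        final-stock : ∀ k → k < n → (if k <ᵇ n then flow n k n else 0) ≡ stock ch n k
        final-stock k k<n rewrite <ᵇ-true k<n | ≡ᵇ-refl n = refl

      netflow : ∀ u → u < suc n → ℤ.+ outgoing u ℤ.- ℤ.+ incoming u ≡ (if u ≡ᵇ n then ℤ.- ℤ.+ n else ℤ.+ 1)
      netflow u u<1+n with m<1+n⇒m<n∨m≡n u<1+n
      ... | inj₂ refl rewrite outgoing-sink | incoming-sink | ≡ᵇ-refl u = ℤᵖ.+-identityˡ (ℤ.- ℤ.+ u)
      ... | inj₁ u<n rewrite outgoing-inner u u<n | incoming-inner u u<n | ≡ᵇ-false (<⇒≢ u<n) = +[1+m]-+m≡1 (deg u)

      weights : Weights n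
      weights i j = flow n (toℕ i) (toℕ j)

      weights-isFlow : IsFlow n (Nvec n) weights
      weights-isFlow = non-edges , netflows
        where
        non-edges : ∀ i j → (toℕ i <ᵇ toℕ j) ≡ false → weights i j ≡ 0
        non-edges i j i≮j rewrite i≮j = refl
        netflows : ∀ i → ℤ.+ outflow weights i ℤ.- ℤ.+ inflow weights i ≡ Nvec n i
        netflows i rewrite sumFin≡∑< (suc n) (λ w → if toℕ i <ᵇ w then flow n (toℕ i) w else 0)
                         | sumFin≡∑< (suc n) (λ k → if k <ᵇ toℕ i then flow n k (toℕ i) else 0) =
          netflow (toℕ i) (toℕ<n i)

  AgreeBefore : (ℕ → ℕ → ℕ) → (ℕ → ℕ → ℕ) → ℕ → Set
  AgreeBefore ch₁ ch₂ v = ∀ w → w < v → a ≤ w → ∀ k → k < t → ch₁ w k ≡ ch₂ w k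

  picks-cong : ∀ ch₁ ch₂ {s₁ s₂ : ℕ → ℕ} v u → (∀ u → s₁ u ≡ s₂ u) →
    (a ≤ v → ∀ k → k < t → ch₁ v k ≡ ch₂ v k) → picks ch₁ s₁ v u ≡ picks ch₂ s₂ v u
  picks-cong ch₁ ch₂ {s₁} {s₂} v u s₁≡s₂ agree with a ≤? v
  ... | no  a≰v rewrite ≤ᵇ-false a≰v = refl
  ... | yes a≤v rewrite ≤ᵇ-true a≤v | s₁≡s₂ u | rank-cong s₁≡s₂ u
                      | selects-cong (rank s₂ u) (agree a≤v) = refl

  stock-cong : ∀ ch₁ ch₂ v → AgreeBefore ch₁ ch₂ v → ∀ u → stock ch₁ v u ≡ stock ch₂ v u
  stock-cong ch₁ ch₂ zero    agree u = refl
  stock-cong ch₁ ch₂ (suc v) agree u =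
    cong (λ x → if u ≡ᵇ v then suc (deg v) else x)
      (cong₂ _∸_ (stock-cong ch₁ ch₂ v agree′ u)
        (cong 𝟙 (picks-cong ch₁ ch₂ v u (stock-cong ch₁ ch₂ v agree′) (agree v ≤-refl))))
    where
    agree′ : AgreeBefore ch₁ ch₂ v
    agree′ w w<v = agree w (m<n⇒m<1+n w<v)

  -- The stocks still agree at v, so the vertex of rank k * L + ch₁ v k is picked by ch₁ only.
  sends-differ : ∀ ch₁ ch₂ → (∀ v k → ch₁ v k < L) → suc t * (t * L) ≤ a →
    ∀ v → a ≤ v → AgreeBefore ch₁ ch₂ v → ∀ k → k < t → ch₁ v k ≢ ch₂ v k →
    Σ ℕ λ u → u < v × sends ch₁ v u ≡ true × sends ch₂ v u ≡ false
  sends-differ ch₁ ch₂ ch₁<L tL≤a v a≤v agree k k<t differ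
    with vertex-of-rank (stock ch₁ v) v (k * L + ch₁ v k) r<rank
    where
    r<rank : k * L + ch₁ v k < rank (stock ch₁ v) v
    r<rank = <-≤-trans (m*n+o<k*n k<t (ch₁<L v k)) (Run.stocked≥t*L ch₁ ch₁<L tL≤a v a≤v)
  ... | u , u<v , positive-u , rank-u = u , u<v , picked₁ , not-picked₂
    where
    r : ℕ
    r = k * L + ch₁ v k
    same-stock : ∀ u → stock ch₁ v u ≡ stock ch₂ v u
    same-stock = stock-cong ch₁ ch₂ v agree
    r<tL : r < t * L
    r<tL = m*n+o<k*n k<t (ch₁<L v k)
    picked₁ : sends ch₁ v u ≡ true
    picked₁ rewrite ≤ᵇ-true a≤v | positive-u | rank-u | selects-< (ch₁ v) r<tL
                  | [m*n+o]%n≡o k L _ (ch₁<L v k) | [m*n+o]/n≡m k L _ (ch₁<L v k) = ≡ᵇ-refl (ch₁ v k)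
    not-picked₂ : sends ch₂ v u ≡ false
    not-picked₂ rewrite ≤ᵇ-true a≤v | sym (same-stock u) | positive-u | sym (rank-cong same-stock u)
                      | rank-u | selects-< (ch₂ v) r<tL
                      | [m*n+o]%n≡o k L _ (ch₁<L v k) | [m*n+o]/n≡m k L _ (ch₁<L v k) = ≡ᵇ-false differ

digit : (L : ℕ) .{{_ : NonZero L}} → ℕ → ℕ → ℕ
digit L x zero    = x % L
digit L x (suc s) = digit L (x / L) s

digit<base : ∀ L .{{_ : NonZero L}} x s → digit L x s < L
digit<base L x zero    = m%n<n x L
digit<base L x (suc s) = digit<base L (x / L) s

first-differing-digit : ∀ L .{{_ : NonZero L}} m {x y} → x < L ^ m → y < L ^ m → x ≢ y →
  Σ ℕ λ s → s < m × digit L x s ≢ digit L y s × (∀ r → r < s → digit L x r ≡ digit L y r)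
first-differing-digit L zero {zero}  {zero}  _         _         x≢y = ⊥-elim (x≢y refl)
first-differing-digit L zero {suc _} {_}     (s≤s ()) _         _
first-differing-digit L zero {_}     {suc _} _         (s≤s ()) _
first-differing-digit L (suc m) {x} {y} x<Lᵐ⁺¹ y<Lᵐ⁺¹ x≢y with x % L ≟ y % L
... | no  differ = 0 , z<s , differ , λ _ ()
... | yes same
  with first-differing-digit L m (quotient< x<Lᵐ⁺¹) (quotient< y<Lᵐ⁺¹) quotients-differ
  where
  quotient< : ∀ {z} → z < L * L ^ m → z / L < L ^ m
  quotient< {z} z< = m<n*o⇒m/o<n (subst (z <_) (*-comm L (L ^ m)) z<)
  quotients-differ : x / L ≢ y / L
  quotients-differ same/ = x≢y (begin
    x                 ≡⟨ m≡m%n+[m/n]*n x L ⟩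
    x % L + x / L * L ≡⟨ cong₂ (λ p q → p + q * L) same same/ ⟩
    y % L + y / L * L ≡⟨ m≡m%n+[m/n]*n y L ⟨
    y                 ∎)
    where open ≡-Reasoning
...   | s , s<m , differ , agree = suc s , s<s s<m , differ , agree′
  where
  agree′ : ∀ r → r < suc s → digit L x r ≡ digit L y r
  agree′ zero    _         = same
  agree′ (suc r) (s<s r<s) = agree r r<s

-- The family indexed by x < L ^ ((n ∸ a) * t): vertex v ≥ a uses the digits (v ∸ a) * t + k, k < t, of x.
module Family (n a t L : ℕ) .{{_ : NonZero L}} (tL≤a : suc t * (t * L) ≤ a) where
  open Greedy a t L

  choice : ℕ → ℕ → ℕ → ℕ
  choice x v k = digit L x ((v ∸ a) * t + k)

  choice<L : ∀ x v k → choice x v k < L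
  choice<L x v k = digit<base L x ((v ∸ a) * t + k)

  flowOf : ℕ → ℕ → ℕ → ℕ
  flowOf x = Run.flow (choice x) (choice<L x) tL≤a n

  flows-differ : ∀ {x y} → x < L ^ ((n ∸ a) * t) → y < L ^ ((n ∸ a) * t) → x ≢ y →
    Σ ℕ λ u → Σ ℕ λ v → u < v × v < n × flowOf x u v ≡ 1 × flowOf y u v ≡ 0
  flows-differ {x} {y} x< y< x≢y with first-differing-digit L ((n ∸ a) * t) x< y< x≢y
  ... | s , s<m , differ , agree = at-block {{≢-nonZero t≢0}}
    where
    t≢0 : t ≢ 0
    t≢0 refl = n≮0 (subst (s <_) (*-zeroʳ (n ∸ a)) s<m)
    at-block : .{{_ : NonZero t}} →
      Σ ℕ λ u → Σ ℕ λ v → u < v × v < n × flowOf x u v ≡ 1 × flowOf y u v ≡ 0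
    at-block with sends-differ (choice x) (choice y) (choice<L x) tL≤a v (m≤m+n a (s / t))
                               earlier-agree (s % t) (m%n<n s t) differs-at-v
      where
      v : ℕ
      v = a + s / t
      slot : ∀ k → (v ∸ a) * t + k ≡ s / t * t + k
      slot k = cong (λ q → q * t + k) (m+n∸m≡n a (s / t))
      differs-at-v : choice x v (s % t) ≢ choice y v (s % t)
      differs-at-v same rewrite slot (s % t) | +-comm (s / t * t) (s % t) | sym (m≡m%n+[m/n]*n s t) = differ same
      earlier-agree : AgreeBefore (choice x) (choice y) v
      earlier-agree w w<v a≤w k k<t = agree ((w ∸ a) * t + k) (begin-strict
        (w ∸ a) * t + k <⟨ m*n+o<k*n (∸-monoˡ-< w<v a≤w) k<t ⟩
        (v ∸ a) * t     ≡⟨ cong (_* t) (m+n∸m≡n a (s / t)) ⟩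
        s / t * t       ≤⟨ m/n*n≤m s t ⟩
        s               ∎)
        where open ≤-Reasoning
    ... | u , u<v , sends-x , sends-y = u , a + s / t , u<v , v<n , edge-x , edge-y
      where
      v : ℕ
      v = a + s / t
      q<n∸a : s / t < n ∸ a
      q<n∸a = m<n*o⇒m/o<n s<m
      v<n : v < n
      v<n = subst (v <_) (m+[n∸m]≡n {a} {n} (<⇒≤ (m∸n≢0⇒n<m (λ n∸a≡0 → n≮0 (subst (s / t <_) n∸a≡0 q<n∸a)))))
                  (+-monoʳ-< a q<n∸a)
      edge-x : flowOf x u v ≡ 1
      edge-x rewrite <ᵇ-true u<v | ≡ᵇ-false (<⇒≢ v<n) | sends-x = refl
      edge-y : flowOf y u v ≡ 0
      edge-y rewrite <ᵇ-true u<v | ≡ᵇ-false (<⇒≢ v<n) | sends-y = refl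

  family : KAtLeast n (Nvec n) (L ^ ((n ∸ a) * t))
  family = weightsOf , (λ m → Run.weights-isFlow (choice (toℕ m)) (choice<L (toℕ m)) tL≤a n) , distinct
    where
    weightsOf : Fin (L ^ ((n ∸ a) * t)) → Weights n
    weightsOf m i j = flowOf (toℕ m) (toℕ i) (toℕ j)
    distinct : ∀ m₁ m₂ → m₁ ≢ m₂ → ∃ λ i → ∃ λ j → weightsOf m₁ i j ≢ weightsOf m₂ i j
    distinct m₁ m₂ m₁≢m₂ with flows-differ (toℕ<n m₁) (toℕ<n m₂) (m₁≢m₂ ∘ toℕ-injective)
    ... | u , v , u<v , v<n , x-edge , y-edge = fromℕ< u<1+n , fromℕ< v<1+n , differs
      where
      v<1+n : v < suc n
      v<1+n = m<n⇒m<1+n v<n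
      u<1+n : u < suc n
      u<1+n = <-trans u<v v<1+n
      differs : weightsOf m₁ (fromℕ< u<1+n) (fromℕ< v<1+n) ≢ weightsOf m₂ (fromℕ< u<1+n) (fromℕ< v<1+n)
      differs rewrite toℕ-fromℕ< u<1+n | toℕ-fromℕ< v<1+n | x-edge | y-edge = λ ()

KAtLeast-mono : ∀ n N {M M′} → M′ ≤ M → KAtLeast n N M → KAtLeast n N M′
KAtLeast-mono n N {M} {M′} M′≤M (g , isFlow , distinct) =
  g ∘ embed , isFlow ∘ embed ,
  λ m₁ m₂ m₁≢m₂ → distinct (embed m₁) (embed m₂) (m₁≢m₂ ∘ inject≤-injective M′≤M M′≤M m₁ m₂)
  where
  embed : Fin M′ → Fin M
  embed m = inject≤ m M′≤M

^-Bernoulli : ∀ m k → m ^ k * (m + k) ≤ suc m ^ k * m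
^-Bernoulli m zero    rewrite +-identityʳ m | +-identityʳ m = ≤-refl
^-Bernoulli m (suc k) = begin
  m * m ^ k * (m + suc k)                 ≤⟨ m≤m+n _ (m ^ k * k) ⟩
  m * m ^ k * (m + suc k) + m ^ k * k     ≡⟨ expand m (m ^ k) k ⟩
  suc m * (m ^ k * (m + k))               ≤⟨ *-monoʳ-≤ (suc m) (^-Bernoulli m k) ⟩
  suc m * (suc m ^ k * m)                 ≡⟨ *-assoc (suc m) (suc m ^ k) m ⟨
  suc m * suc m ^ k * m                   ∎
  where
  open ≤-Reasoning
  expand : ∀ m x k → m * x * (m + suc k) + x * k ≡ suc m * (x * (m + k))
  expand = solve-∀

2*m^m≤[1+m]^m : ∀ m .{{_ : NonZero m}} → 2 * m ^ m ≤ suc m ^ m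
2*m^m≤[1+m]^m m = *-cancelʳ-≤ _ _ m (begin
  2 * m ^ m * m   ≡⟨ reassoc m (m ^ m) ⟩
  m ^ m * (m + m) ≤⟨ ^-Bernoulli m m ⟩
  suc m ^ m * m   ∎)
  where
  open ≤-Reasoning
  reassoc : ∀ m x → 2 * x * m ≡ x * (m + m)
  reassoc = solve-∀

2^m*m!≤2*m^m : ∀ m → 2 ^ m * m ! ≤ 2 * m ^ m
2^m*m!≤2*m^m zero          = s≤s z≤n
2^m*m!≤2*m^m (suc zero)    = ≤-refl
2^m*m!≤2*m^m (suc (suc m)) = begin
  2 * 2 ^ M * (suc M * M !)   ≡⟨ reassoc (suc M) (2 ^ M) (M !) ⟩
  suc M * (2 * (2 ^ M * M !)) ≤⟨ *-monoʳ-≤ (suc M) (*-monoʳ-≤ 2 (2^m*m!≤2*m^m (suc m))) ⟩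
  suc M * (2 * (2 * M ^ M))   ≤⟨ *-monoʳ-≤ (suc M) (*-monoʳ-≤ 2 (2*m^m≤[1+m]^m M)) ⟩
  suc M * (2 * suc M ^ M)     ≡⟨ swap (suc M) (suc M ^ M) ⟩
  2 * (suc M * suc M ^ M)     ∎
  where
  open ≤-Reasoning
  M : ℕ
  M = suc m
  reassoc : ∀ m x y → 2 * x * (m * y) ≡ m * (2 * (x * y))
  reassoc = solve-∀
  swap : ∀ m x → m * (2 * x) ≡ 2 * (m * x)
  swap = solve-∀

^≤expPartial : ∀ m k → m ^ k ≤ expPartial m k
^≤expPartial m zero    = ≤-refl
^≤expPartial m (suc k) = m≤n+m _ _

-- e^m ≥ m^m / m! ≥ 2^m / 2.
ExpLe⇒2^≤2* : ∀ m x → ExpLe m x → 2 ^ m ≤ 2 * x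
ExpLe⇒2^≤2* m x e^m≤x = *-cancelʳ-≤ (2 ^ m) (2 * x) (m !) {{m !≢0}} (begin
  2 ^ m * m !   ≤⟨ 2^m*m!≤2*m^m m ⟩
  2 * m ^ m     ≤⟨ *-monoʳ-≤ 2 (≤-trans (^≤expPartial m m) (e^m≤x m)) ⟩
  2 * (x * m !) ≡⟨ *-assoc 2 x (m !) ⟨
  2 * x * m !   ∎)
  where open ≤-Reasoning

16^j≤n<16^[1+j] : ∀ n → 0 < n → Σ ℕ λ j → 16 ^ j ≤ n × n < 16 ^ suc j
16^j≤n<16^[1+j] = <-rec Bracketed bracket
  where
  open ≤-Reasoning
  Bracketed : ℕ → Set
  Bracketed n = 0 < n → Σ ℕ λ j → 16 ^ j ≤ n × n < 16 ^ suc j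
  bracket : ∀ n → (∀ {m} → m < n → Bracketed m) → Bracketed n
  bracket n rec 0<n with n <? 16
  ... | yes n<16 = 0 , 0<n , n<16
  ... | no  n≮16 with rec (m/n<m n 16 {{>-nonZero 0<n}} (s≤s (s≤s z≤n))) (m≥n⇒m/n>0 (≮⇒≥ n≮16))
  ...   | j , lower , upper = suc j , lower′ , upper′
    where
    lower′ : 16 * 16 ^ j ≤ n
    lower′ = begin
      16 * 16 ^ j  ≤⟨ *-monoʳ-≤ 16 lower ⟩
      16 * (n / 16) ≡⟨ *-comm 16 (n / 16) ⟩
      n / 16 * 16  ≤⟨ m/n*n≤m n 16 ⟩
      n            ∎
    upper′ : n < 16 * (16 * 16 ^ j)
    upper′ = begin-strict
      n                    ≡⟨ m≡m%n+[m/n]*n n 16 ⟩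
      n % 16 + n / 16 * 16 <⟨ +-monoˡ-< (n / 16 * 16) (m%n<n n 16) ⟩
      suc (n / 16) * 16    ≤⟨ *-monoˡ-≤ 16 upper ⟩
      16 * 16 ^ j * 16     ≡⟨ *-comm (16 * 16 ^ j) 16 ⟩
      16 * (16 * 16 ^ j)   ∎

8*[1+j]²≤j*2^j : ∀ j → 10 ≤ j → 8 * (suc j * suc j) ≤ j * 2 ^ j
8*[1+j]²≤j*2^j j 10≤j = subst (λ j → 8 * (suc j * suc j) ≤ j * 2 ^ j) (m+[n∸m]≡n 10≤j) (from10 (j ∸ 10))
  where
  open ≤-Reasoning
  from10 : ∀ i → 8 * ((11 + i) * (11 + i)) ≤ (10 + i) * 2 ^ (10 + i)
  from10 zero    = ≤ᵇ⇒≤ 968 10240 _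
  from10 (suc i) = begin
    8 * ((12 + i) * (12 + i))        ≤⟨ *-monoʳ-≤ 8 square-doubles ⟩
    8 * (2 * ((11 + i) * (11 + i)))  ≡⟨ swap ((11 + i) * (11 + i)) ⟩
    2 * (8 * ((11 + i) * (11 + i)))  ≤⟨ *-monoʳ-≤ 2 (from10 i) ⟩
    2 * ((10 + i) * 2 ^ (10 + i))    ≡⟨ reassoc (10 + i) (2 ^ (10 + i)) ⟩
    (10 + i) * (2 * 2 ^ (10 + i))    ≤⟨ *-monoˡ-≤ (2 * 2 ^ (10 + i)) (n≤1+n (10 + i)) ⟩
    (11 + i) * (2 * 2 ^ (10 + i))    ∎
    where
    excess : ∀ x → 2 * ((11 + x) * (11 + x)) ≡ (12 + x) * (12 + x) + (98 + (20 * x + x * x))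
    excess = solve-∀
    square-doubles : (12 + i) * (12 + i) ≤ 2 * ((11 + i) * (11 + i))
    square-doubles = ≤-trans (m≤m+n _ _) (≤-reflexive (sym (excess i)))
    swap : ∀ x → 8 * (2 * x) ≡ 2 * (8 * x)
    swap = solve-∀
    reassoc : ∀ x y → 2 * (x * y) ≡ x * (2 * y)
    reassoc = solve-∀

ExpLe⇒p≤[1+j]*n*q : ∀ n j p q → n < 16 ^ suc j → ExpLe (4 * p) (n ^ (n * q)) → p ≤ suc j * n * q
ExpLe⇒p≤[1+j]*n*q n j p q upper e^4p≤ = s≤s⁻¹ (*-cancelˡ-< 4 p (suc X) (begin-strict
  4 * p      ≤⟨ ^-cancelˡ-≤ 2 (s≤s (s≤s z≤n)) 2^4p≤ ⟩
  suc (4 * X) <⟨ s≤s (s≤s (m≤n+m (4 * X) 2)) ⟩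
  4 + 4 * X   ≡⟨ *-suc 4 X ⟨
  4 * suc X   ∎))
  where
  open ≤-Reasoning
  X : ℕ
  X = suc j * n * q
  2^4p≤ : 2 ^ (4 * p) ≤ 2 ^ suc (4 * X)
  2^4p≤ = begin
    2 ^ (4 * p)                      ≤⟨ ExpLe⇒2^≤2* (4 * p) (n ^ (n * q)) e^4p≤ ⟩
    2 * n ^ (n * q)                  ≤⟨ *-monoʳ-≤ 2 (^-monoˡ-≤ (n * q) (<⇒≤ upper)) ⟩
    2 * (16 ^ suc j) ^ (n * q)       ≡⟨ cong (λ b → 2 * b ^ (n * q)) (^-*-assoc 2 4 (suc j)) ⟩
    2 * (2 ^ (4 * suc j)) ^ (n * q)  ≡⟨ cong (2 *_) (^-*-assoc 2 (4 * suc j) (n * q)) ⟩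
    2 * 2 ^ (4 * suc j * (n * q))    ≡⟨ cong (λ e → 2 * 2 ^ e) (reassoc (suc j) n q) ⟩
    2 * 2 ^ (4 * X)                  ∎
    where
    reassoc : ∀ x y z → 4 * x * (y * z) ≡ 4 * (x * y * z)
    reassoc = solve-∀

KAtLeast-n^[[1+j]*n] : ∀ n j → 10 ≤ j → 16 ^ j ≤ n → n < 16 ^ suc j → KAtLeast n (Nvec n) (n ^ (suc j * n))
KAtLeast-n^[[1+j]*n] n j 10≤j lower upper =
  KAtLeast-mono n (Nvec n) n^σ≤Lᵈᵗ (Family.family n a t L {{m^n≢0 2 j}} tL≤a)
  where
  open ≤-Reasoning
  t L a d : ℕ
  t = 2 ^ j
  L = 2 ^ j
  a = 2 ^ (suc j + (j + j))
  d = n ∸ a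
  16^≡2^ : ∀ k → 16 ^ k ≡ 2 ^ (4 * k)
  16^≡2^ k = ^-*-assoc 2 4 k
  tL≤a : suc t * (t * L) ≤ a
  tL≤a = begin
    suc t * (t * L)             ≤⟨ *-monoˡ-≤ (t * L) 1+t≤2t ⟩
    2 ^ suc j * (2 ^ j * 2 ^ j) ≡⟨ cong (2 ^ suc j *_) (^-distribˡ-+-* 2 j j) ⟨
    2 ^ suc j * 2 ^ (j + j)     ≡⟨ ^-distribˡ-+-* 2 (suc j) (j + j) ⟨
    a                           ∎
    where
    1+t≤2t : suc t ≤ 2 * t
    1+t≤2t = ≤-trans (+-monoˡ-≤ t (m^n>0 2 j)) (≤-reflexive (cong (t +_) (sym (+-identityʳ t))))
  a+a≤n : a + a ≤ n
  a+a≤n = begin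
    a + a                     ≡⟨ cong (a +_) (+-identityʳ a) ⟨
    2 ^ suc (suc j + (j + j)) ≤⟨ ^-monoʳ-≤ 2 3j+2≤4j ⟩
    2 ^ (4 * j)               ≡⟨ 16^≡2^ j ⟨
    16 ^ j                    ≤⟨ lower ⟩
    n                         ∎
    where
    3j+2≤4j : suc (suc j + (j + j)) ≤ 4 * j
    3j+2≤4j = subst (λ x → suc (suc x + (x + x)) ≤ 4 * x) (m+[n∸m]≡n {2} {j} (≤-trans (s≤s (s≤s z≤n)) 10≤j))
                (≤-trans (m≤m+n _ (j ∸ 2)) (≤-reflexive (sym (expand (j ∸ 2)))))
      where
      expand : ∀ i → 4 * (2 + i) ≡ suc (suc (2 + i) + ((2 + i) + (2 + i))) + i
      expand = solve-∀
  exponents : 4 * suc j * (suc j * n) ≤ j * (d * t)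
  exponents = begin
    4 * suc j * (suc j * n)       ≤⟨ *-monoʳ-≤ (4 * suc j) (*-monoʳ-≤ (suc j) (m+m≤n⇒n≤[n∸m]*2 {a} a+a≤n)) ⟩
    4 * suc j * (suc j * (d * 2)) ≡⟨ reassoc₁ (suc j) d ⟩
    8 * (suc j * suc j) * d       ≤⟨ *-monoˡ-≤ d (8*[1+j]²≤j*2^j j 10≤j) ⟩
    j * 2 ^ j * d                 ≡⟨ reassoc₂ j (2 ^ j) d ⟩
    j * (d * t)                   ∎
    where
    reassoc₁ : ∀ x y → 4 * x * (x * (y * 2)) ≡ 8 * (x * x) * y
    reassoc₁ = solve-∀
    reassoc₂ : ∀ x y z → x * y * z ≡ x * (z * y)
    reassoc₂ = solve-∀
  n^σ≤Lᵈᵗ : n ^ (suc j * n) ≤ L ^ (d * t)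
  n^σ≤Lᵈᵗ = begin
    n ^ (suc j * n)                      ≤⟨ ^-monoˡ-≤ (suc j * n) (<⇒≤ upper) ⟩
    (16 ^ suc j) ^ (suc j * n)           ≡⟨ cong (_^ (suc j * n)) (16^≡2^ (suc j)) ⟩
    (2 ^ (4 * suc j)) ^ (suc j * n)      ≡⟨ ^-*-assoc 2 (4 * suc j) (suc j * n) ⟩
    2 ^ (4 * suc j * (suc j * n))        ≤⟨ ^-monoʳ-≤ 2 exponents ⟩
    2 ^ (j * (d * t))                    ≡⟨ ^-*-assoc 2 j (d * t) ⟨
    L ^ (d * t)                          ∎

KAtLeast-[1+n]^[n∸1] : ∀ n → 3000 ≤ n → KAtLeast n (Nvec n) (suc n ^ (n ∸ 1))
KAtLeast-[1+n]^[n∸1] n 3000≤n =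
  KAtLeast-mono n (Nvec n) bound (Family.family n a 4 L {{>-nonZero (≤-trans (s≤s z≤n) 75≤L)}} tL≤a)
  where
  open ≤-Reasoning
  L a d : ℕ
  L = n / 40
  a = 20 * L
  d = n ∸ a
  75≤L : 75 ≤ L
  75≤L = /-monoˡ-≤ 40 3000≤n
  tL≤a : 5 * (4 * L) ≤ 20 * L
  tL≤a = ≤-reflexive (reassoc L)
    where
    reassoc : ∀ x → 5 * (4 * x) ≡ 20 * x
    reassoc = solve-∀
  1+n≤L² : suc n ≤ L * L
  1+n≤L² = begin
    suc n                   ≡⟨ cong suc (m≡m%n+[m/n]*n n 40) ⟩
    suc (n % 40 + L * 40)   ≤⟨ +-monoˡ-≤ (L * 40) (m%n<n n 40) ⟩
    40 + L * 40             ≤⟨ +-monoˡ-≤ (L * 40) (≤-trans (≤ᵇ⇒≤ 40 2625 _) (*-monoˡ-≤ 35 75≤L)) ⟩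
    L * 35 + L * 40         ≡⟨ collect L ⟩
    L * 75                  ≤⟨ *-monoʳ-≤ L 75≤L ⟩
    L * L                   ∎
    where
    collect : ∀ x → x * 35 + x * 40 ≡ x * 75
    collect = solve-∀
  a+a≤n : a + a ≤ n
  a+a≤n = ≤-trans (≤-reflexive (reassoc L)) (m/n*n≤m n 40)
    where
    reassoc : ∀ x → 20 * x + 20 * x ≡ x * 40
    reassoc = solve-∀
  bound : suc n ^ (n ∸ 1) ≤ L ^ (d * 4)
  bound = begin
    suc n ^ (n ∸ 1)    ≤⟨ ^-monoʳ-≤ (suc n) (≤-trans (m∸n≤m n 1) (m+m≤n⇒n≤[n∸m]*2 {a} a+a≤n)) ⟩
    suc n ^ (d * 2)    ≤⟨ ^-monoˡ-≤ (d * 2) 1+n≤L² ⟩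
    (L * L) ^ (d * 2)  ≡⟨ cong (λ x → (L * x) ^ (d * 2)) (*-identityʳ L) ⟨
    (L ^ 2) ^ (d * 2)  ≡⟨ ^-*-assoc L 2 (d * 2) ⟩
    L ^ (2 * (d * 2))  ≡⟨ cong (L ^_) (reassoc d) ⟩
    L ^ (d * 4)        ∎
    where
    reassoc : ∀ x → 2 * (x * 2) ≡ x * 4
    reassoc = solve-∀

KAtLeast-of-ExpLe : ∀ n → 16 ^ 10 ≤ n → ∀ p q → ExpLe (4 * p) (n ^ (n * q)) →
  ∀ M → (M ∸ 1) ^ q < n ^ p → KAtLeast n (Nvec n) M
KAtLeast-of-ExpLe n 16¹⁰≤n p q e^4p≤ M [M∸1]^q<nᵖ with 16^j≤n<16^[1+j] n (≤-trans (m^n>0 16 10) 16¹⁰≤n)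
... | j , lower , upper = KAtLeast-mono n (Nvec n) M≤n^σ (KAtLeast-n^[[1+j]*n] n j 10≤j lower upper)
  where
  open ≤-Reasoning
  10≤j : 10 ≤ j
  10≤j = s≤s⁻¹ (^-cancelˡ-< 16 (≤-<-trans 16¹⁰≤n upper))
  M≤n^σ : M ≤ n ^ (suc j * n)
  M≤n^σ = [m∸1]^q<n^q⇒m≤n M (n ^ (suc j * n)) q (begin-strict
    (M ∸ 1) ^ q           <⟨ [M∸1]^q<nᵖ ⟩
    n ^ p                 ≤⟨ ^-monoʳ-≤ n {{>-nonZero (≤-trans (m^n>0 16 j) lower)}} (ExpLe⇒p≤[1+j]*n*q n j p q upper e^4p≤) ⟩
    n ^ (suc j * n * q)   ≡⟨ ^-*-assoc n (suc j * n) q ⟨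
    (n ^ (suc j * n)) ^ q ∎)

theorem5p2 : (Σ ℕ λ C → Σ ℕ λ N₀ → ∀ n → N₀ ≤ n → ∀ p q → 0 < q →
    ExpLe (4 * p + 4 * C * n * q) (n ^ (n * q)) →
    ∀ M → (M ∸ 1) ^ q < n ^ p → KAtLeast n (Nvec n) M)
    ×
    (∀ n → 3000 ≤ n → KAtLeast n (Nvec n) (suc n ^ (n ∸ 1)))
theorem5p2 = (0 , 16 ^ 10 , large-n) , KAtLeast-[1+n]^[n∸1]
  where
  large-n : ∀ n → 16 ^ 10 ≤ n → ∀ p q → 0 < q → ExpLe (4 * p + 0) (n ^ (n * q)) →
            ∀ M → (M ∸ 1) ^ q < n ^ p → KAtLeast n (Nvec n) M
  large-n n 16¹⁰≤n p q _ e^4p≤ =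
    KAtLeast-of-ExpLe n 16¹⁰≤n p q (subst (λ e → ExpLe e (n ^ (n * q))) (+-identityʳ (4 * p)) e^4p≤)
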